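{- Let $D=(V,A)$ be a digraph. Then $D$ is a comparability digraph if and only if the knotting graph $\tilde{K}_D$ is bipartite and there exists a bipartition $(X,Y)$ of $\tilde{K}_D$ such that the orientation of $\tilde{K}_D$ in which every edge is oriented from its end in $X$ to its end in $Y$ transforms into an acyclic orientation of the underlying graph $U(D)$.
   Context: A digraph $D=(V,A)$ is finite, without loops or multiple arcs; write $uv\in A$ for an arc from $u$ to $v$. A comparability ordering of $D$ is a linear ordering $\prec$ of $V$ such that for all $x\prec y\prec z$: $xy,yz\in A$ implies $xz\in A$, and $zy,yx\in A$ implies $zx\in A$. $D$ is a comparability digraph if it has a comparability ordering. Let $Z_D=\{(x,y): xy\in A\text{ or }yx\in A\}$. For $(x,y),(x',y')\in Z_D$ write $(x,y)\Gamma(x',y')$ ("directly forces") if one of the following holds: (i) $x=x'$ and $y=y'$; (ii) $x=x'$, $y\ne y'$, and either ($yx,x'y'\in A$ and $yy'\notin A$) or ($y'x',xy\in A$ and $y'y\notin A$); (iii) $y=y'$, $x\ne x'$, and either ($xy,y'x'\in A$ and $xx'\notin A$) or ($x'y',yx\in A$ and $x'x\notin A$). For a vertex $x$, two pairs $(x,y),(x,z)\in Z_D$ are knotted if there are $y=y_0,y_1,\dots,y_k=z$ with $(x,y_{i-1})\Gamma(x,y_i)$ for all $1\le i\le k$; this is an equivalence relation and partitions the set $N(x)=\{y:(x,y)\in Z_D\}$ into classes $x^1,\dots,x^{\ell_x}$ (called partial copies of $x$). The knotting graph $\tilde K_D$ is the graph whose vertices are all partial copies $x^\alpha$ for all $x\in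 V$, with an edge $x^\alpha y^\beta$ whenever $x,y$ are adjacent in $D$, $y\in x^\alpha$ and $x\in y^\beta$; thus each pair of adjacent vertices $x,y$ of $D$ gives exactly one edge $x^\alpha y^\beta$ of $\tilde K_D$. The underlying graph $U(D)$ is the simple graph on $V$ with $xy$ an edge iff $xy\in A$ or $yx\in A$. An orientation of $\tilde K_D$ transforms into an orientation of $U(D)$ by orienting the edge $xy$ of $U(D)$ from $x$ to $y$ whenever the corresponding edge $x^\alpha y^\beta$ of $\tilde K_D$ is oriented from $x^\alpha$ to $y^\beta$. -}

module Defs where

open import Data.Nat using (ℕ)
open import Data.Fin using (Fin)
open import Data.Bool using (Bool; true; false; T)
open import Data.Product using (Σ; ∃; ∃-syntax; _×_; _,_)
open import Data.Sum using (_⊎_)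
open import Data.Empty using (⊥)
open import Relation.Nullary using (¬_)
open import Relation.Binary.PropositionalEquality using (_≡_; _≢_)
open import Relation.Binary.Structures using (IsStrictTotalOrder)
open import Relation.Binary.Construct.Closure.ReflexiveTransitive using (Star)
open import Relation.Binary.Construct.Closure.Transitive using (TransClosure)

-- A finite digraph on vertex set Fin n: arcs given by a Boolean adjacency
-- function; no loops.  (No multiple arcs is automatic.)
record Digraph : Set where
  field
    n        : ℕ
    adj      : Fin n → Fin n → Bool
    loopless : ∀ x → adj x x ≡ false

module _ (D : Digraph) where
  open Digraph D

  V : Set
  V = Fin n

  Arc : V → V → Set
  Arc x y = T (adj x y)

  IsComparabilityOrdering : (V → V → Set) → Set
  IsComparabilityOrdering _≺_ =
    IsStrictTotalOrder _≡_ _≺_ ×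
    (∀ x y z → x ≺ y → y ≺ z →
       (Arc x y → Arc y z → Arc x z) × (Arc z y → Arc y x → Arc z x))

  IsComparabilityDigraph : Set₁
  IsComparabilityDigraph = Σ (V → V → Set) IsComparabilityOrdering

  Adjacent : V → V → Set
  Adjacent x y = Arc x y ⊎ Arc y x

  Forces : V → V → V → V → Set
  Forces x y x' y' =
    (x ≡ x' × y ≡ y')
    ⊎ (x ≡ x' × y ≢ y' ×
        ((Arc y x × Arc x' y' × ¬ Arc y y') ⊎ (Arc y' x' × Arc x y × ¬ Arc y' y)))
    ⊎ (y ≡ y' × x ≢ x' ×
        ((Arc x y × Arc y' x' × ¬ Arc x x') ⊎ (Arc x' y' × Arc y x × ¬ Arc x' x)))

  KnotStep : V → V → V → Set
  KnotStep x y z = Adjacent x y × Adjacent x z × Forces x y x z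

  Knotted : V → V → V → Set
  Knotted x = Star (KnotStep x)

  -- The partial
  -- copy of x containing y ∈ N(x) is represented by the pair (x , y); a
  -- colouring col is a function on partial copies iff it is constant on
  -- knotted classes.  col x y ≡ true means the partial copy of x containing y
  -- lies in X, false means it lies in Y.
  RespectsCopies : (V → V → Bool) → Set
  RespectsCopies col =
    ∀ x y z → Adjacent x y → Adjacent x z → Knotted x y z → col x y ≡ col x z

  -- (X , Y) is a bipartition of K̃_D: every edge x^α y^β (x, y adjacent,
  -- y ∈ x^α, x ∈ y^β) has one end in X and one end in Y.
  IsBipartition : (V → V → Bool) → Set
  IsBipartition col = ∀ x y → Adjacent x y → col x y ≢ col y x

  -- orientation of U(D) induced by orienting each edge of K̃_D from X to Y:
  -- the edge xy is oriented x → y iff x^α (the copy of x containing y) is in X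
  InducedOrientation : (V → V → Bool) → V → V → Set
  InducedOrientation col x y = Adjacent x y × col x y ≡ true

  Acyclic : (V → V → Set) → Set
  Acyclic _⇒_ = ∀ x → ¬ TransClosure _⇒_ x x

-- A comparability ordering ≺ colours the partial copy of x containing y by
-- whether y lies above x.  A forcing step (x , y) Γ (x , z) with y and z on
-- opposite sides of x would witness a violation of one of the two transitivity
-- conditions at y ≺ x ≺ z, so knotted neighbours lie on the same side of x:
-- the colouring is well defined on partial copies, the two ends of an edge of
-- K̃_D get different colours, and the induced orientation follows ≺.
-- Conversely, any linear extension ≺ of the acyclic induced orientation is a
-- comparability ordering: a violation at x ≺ y ≺ z would make (y , x) force
-- (y , z), although x and z lie on opposite sides of y and hence are
-- neighbours in differently coloured partial copies of y.

module Submission where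

open import Defs
open import Data.Bool using (Bool; true; false)
open import Data.Bool.Properties using () renaming (_≟_ to _≟ᵇ_)
open import Data.Empty using (⊥; ⊥-elim)
open import Data.Fin using (Fin; zero; punchIn; punchOut; toℕ)
open import Data.Fin.Properties using (any?; pigeonhole; punchIn-punchOut)
  renaming (_≟_ to _≟ᶠ_)
open import Data.Nat using (ℕ; suc; _<_; z<s; s<s)
open import Data.Nat.Properties using (<-irrefl; <-trans; <-cmp; n<1+n; m<1+n⇒m<n∨m≡n; suc-injective)
open import Data.Product using (Σ; ∃; _×_; _,_; proj₁; proj₂; uncurry)
open import Data.Sum using (inj₁; inj₂)
open import Function.Base using (_∘_; _on_)
open import Function.Bundles using (_⇔_; mk⇔)
open import Function.Definitions using (Injective)
open import Level using (Level; 0ℓ)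
open import Relation.Binary.Core using (Rel; _⇒_)
open import Relation.Binary.Definitions using (Decidable; Transitive; Tri; tri<; tri≈; tri>)
open import Relation.Binary.Structures using (IsStrictTotalOrder)
open import Relation.Binary.PropositionalEquality
open import Relation.Binary.Construct.Closure.ReflexiveTransitive using (ε; _◅_; fold)
open import Relation.Binary.Construct.Closure.Transitive using (TransClosure; [_]; _∷_; _++_)
open import Relation.Nullary using (¬_; yes; no; does)
open import Relation.Nullary.Decidable
  using (¬?; T?; _×-dec_; _⊎-dec_; decidable-stable; dec-true; dec-false; does-⇔)
open import Relation.Nullary.Negation using (contradiction)

private
  variable
    a ℓ ℓ′ : Level
    A : Set a

transClosure-least : {R : Rel A ℓ} {S : Rel A ℓ′} →
                     Transitive S → R ⇒ S → TransClosure R ⇒ S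
transClosure-least S-trans R⇒S [ r ]    = R⇒S r
transClosure-least S-trans R⇒S (r ∷ rs) = S-trans (R⇒S r) (transClosure-least S-trans R⇒S rs)

injective⇒isStrictTotalOrder : {r : A → ℕ} → Injective _≡_ _≡_ r →
                               IsStrictTotalOrder _≡_ (_<_ on r)
injective⇒isStrictTotalOrder {r = r} r-injective = record
  { isStrictPartialOrder = record
    { isEquivalence = isEquivalence
    ; irrefl        = λ { refl → <-irrefl refl }
    ; trans         = <-trans
    ; <-resp-≈      = resp₂ (_<_ on r)
    }
  ; compare = compare
  }
  where
  compare : ∀ x y → Tri (r x < r y) (x ≡ y) (r y < r x)
  compare x y with <-cmp (r x) (r y)
  ... | tri< lt ≢ ≯ = tri< lt (≢ ∘ cong r) ≯
  ... | tri≈ ≮ eq ≯ = tri≈ ≮ (r-injective eq) ≯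
  ... | tri> ≮ ≢ gt = tri> ≮ (≢ ∘ cong r) gt

module _ {n} {R : Rel (Fin (suc n)) ℓ} (predecessor : ∀ m → ∃ λ x → R x m) where
  private
    walk : ℕ → Fin (suc n)
    walk ℕ.zero  = zero
    walk (suc k) = proj₁ (predecessor (walk k))

    walk-descends : ∀ {i j} → i < j → TransClosure R (walk j) (walk i)
    walk-descends {i} {suc j} i<1+j with m<1+n⇒m<n∨m≡n i<1+j
    ... | inj₁ i<j  = proj₂ (predecessor (walk j)) ∷ walk-descends i<j
    ... | inj₂ refl = [ proj₂ (predecessor (walk i)) ]

  predecessors⇒cycle : ∃ λ x → TransClosure R x x
  predecessors⇒cycle with i , j , i<j , walk-i≡walk-j ← pigeonhole (n<1+n (suc n)) (walk ∘ toℕ)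
    = walk (toℕ i) , subst (λ w → TransClosure R w (walk (toℕ i))) (sym walk-i≡walk-j) (walk-descends i<j)

acyclic⇒source : ∀ {n} {R : Rel (Fin (suc n)) ℓ} → Decidable R →
                 (∀ x → ¬ TransClosure R x x) → ∃ λ m → ∀ x → ¬ R x m
acyclic⇒source R? acyclic with any? (λ m → ¬? (any? (λ x → R? x m)))
... | yes (m , no-predecessor) = m , λ x xRm → no-predecessor (x , xRm)
... | no no-source = ⊥-elim (uncurry acyclic (predecessors⇒cycle λ m →
        decidable-stable (any? (λ x → R? x m)) (λ none → no-source (m , none))))

acyclic⇒ranking : ∀ {n} {R : Rel (Fin n) ℓ} → Decidable R → (∀ x → ¬ TransClosure R x x) →
                  ∃ λ (r : Fin n → ℕ) → Injective _≡_ _≡_ r × R ⇒ (_<_ on r)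
acyclic⇒ranking {n = ℕ.zero} R? acyclic = (λ ()) , (λ { {()} }) , (λ { {()} })
acyclic⇒ranking {n = suc n} {R = R} R? acyclic
  with m , source ← acyclic⇒source R? acyclic
  with r₋ , r₋-injective , r₋-monotone ←
         acyclic⇒ranking (λ i j → R? (punchIn m i) (punchIn m j))
           (λ x cycle → acyclic (punchIn m x) (transClosure-least {S = TransClosure R on punchIn m} _++_ [_] cycle))
  = rank , rank-injective , rank-monotone
  where
  rank : Fin (suc n) → ℕ
  rank x with m ≟ᶠ x
  ... | yes _   = 0
  ... | no m≢x = suc (r₋ (punchOut m≢x))

  rank-injective : Injective _≡_ _≡_ rank
  rank-injective {x} {y} with m ≟ᶠ x | m ≟ᶠ y
  ... | yes m≡x | yes m≡y = λ _ → trans (sym m≡x) m≡y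
  ... | yes _   | no _    = λ ()
  ... | no _    | yes _   = λ ()
  ... | no m≢x  | no m≢y  = λ same → begin
    x                        ≡⟨ punchIn-punchOut m≢x ⟨
    punchIn m (punchOut m≢x) ≡⟨ cong (punchIn m) (r₋-injective (suc-injective same)) ⟩
    punchIn m (punchOut m≢y) ≡⟨ punchIn-punchOut m≢y ⟩
    y                        ∎
    where open ≡-Reasoning

  rank-monotone : R ⇒ (_<_ on rank)
  rank-monotone {x} {y} xRy with m ≟ᶠ x | m ≟ᶠ y
  ... | _       | yes refl = ⊥-elim (source x xRy)
  ... | yes _   | no _     = z<s
  ... | no m≢x  | no m≢y   =
    s<s (r₋-monotone (subst₂ R (sym (punchIn-punchOut m≢x)) (sym (punchIn-punchOut m≢y)) xRy))

acyclic⇒linearExtension : ∀ {n} {R : Rel (Fin n) ℓ} → Decidable R → (∀ x → ¬ TransClosure R x x) →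
                          ∃ λ (_≺_ : Rel (Fin n) 0ℓ) → IsStrictTotalOrder _≡_ _≺_ × R ⇒ _≺_
acyclic⇒linearExtension R? acyclic with r , r-injective , r-monotone ← acyclic⇒ranking R? acyclic
  = (_<_ on r) , injective⇒isStrictTotalOrder r-injective , r-monotone

module DigraphProperties (D : Digraph) where

  adjacent⇒≢ : ∀ {x y} → Adjacent D x y → x ≢ y
  adjacent⇒≢ {x} (inj₁ xy) refl rewrite Digraph.loopless D x = xy
  adjacent⇒≢ {x} (inj₂ yx) refl rewrite Digraph.loopless D x = yx

  Adjacent-sym : ∀ {x y} → Adjacent D x y → Adjacent D y x
  Adjacent-sym (inj₁ xy) = inj₂ xy
  Adjacent-sym (inj₂ yx) = inj₁ yx

  Forces-swap : ∀ {x y z} → Forces D x y x z → Forces D x z x y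
  Forces-swap (inj₁ (_ , y≡z))                 = inj₁ (refl , sym y≡z)
  Forces-swap (inj₂ (inj₁ (_ , y≢z , inj₁ f))) = inj₂ (inj₁ (refl , ≢-sym y≢z , inj₂ f))
  Forces-swap (inj₂ (inj₁ (_ , y≢z , inj₂ f))) = inj₂ (inj₁ (refl , ≢-sym y≢z , inj₁ f))
  Forces-swap (inj₂ (inj₂ (_ , x≢x , _)))      = ⊥-elim (x≢x refl)

  KnotStep-sym : ∀ {x y z} → KnotStep D x y z → KnotStep D x z y
  KnotStep-sym (xy , xz , f) = xz , xy , Forces-swap f

module FromComparabilityOrdering (D : Digraph) {_≺_ : V D → V D → Set}
                                 (comparability : IsComparabilityOrdering D _≺_) where
  open DigraphProperties D
  open IsStrictTotalOrder (proj₁ comparability)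
    using (compare; _<?_; irrefl; asym) renaming (trans to ≺-trans)

  unforced-across : ∀ {x y z} → y ≺ x → x ≺ z → ¬ Forces D x y x z
  unforced-across y≺x x≺z (inj₁ (_ , refl)) = irrefl refl (≺-trans y≺x x≺z)
  unforced-across y≺x x≺z (inj₂ (inj₁ (_ , _ , inj₁ (yx , xz , ¬yz)))) =
    ¬yz (proj₁ (proj₂ comparability _ _ _ y≺x x≺z) yx xz)
  unforced-across y≺x x≺z (inj₂ (inj₁ (_ , _ , inj₂ (zx , xy , ¬zy)))) =
    ¬zy (proj₂ (proj₂ comparability _ _ _ y≺x x≺z) zx xy)
  unforced-across _ _ (inj₂ (inj₂ (_ , x≢x , _))) = x≢x refl

  knotStep-preserves-≺ : ∀ {x y z} → KnotStep D x y z → x ≺ y → x ≺ z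
  knotStep-preserves-≺ {x} {y} {z} (_ , xz , f) x≺y with compare x z
  ... | tri< x≺z _ _ = x≺z
  ... | tri≈ _ x≡z _ = ⊥-elim (adjacent⇒≢ xz x≡z)
  ... | tri> _ _ z≺x = ⊥-elim (unforced-across z≺x x≺y (Forces-swap f))

  above : V D → V D → Bool
  above x y = does (x <? y)

  above-respectsCopies : RespectsCopies D above
  above-respectsCopies x _ _ _ _ = fold (λ y z → above x y ≡ above x z) (trans ∘ step) refl
    where
    step : ∀ {y z} → KnotStep D x y z → above x y ≡ above x z
    step {y} {z} s =
      does-⇔ (mk⇔ (knotStep-preserves-≺ s) (knotStep-preserves-≺ (KnotStep-sym s))) (x <? y) (x <? z)

  above-isBipartition : IsBipartition D above
  above-isBipartition x y xy same = separated (compare x y)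
    where
    separated : Tri (x ≺ y) (x ≡ y) (y ≺ x) → ⊥
    separated (tri< x≺y _ _) =
      contradiction (trans (sym (dec-true (x <? y) x≺y)) (trans same (dec-false (y <? x) (asym x≺y)))) λ ()
    separated (tri≈ _ x≡y _) = adjacent⇒≢ xy x≡y
    separated (tri> _ _ y≺x) =
      contradiction (trans (sym (dec-true (y <? x) y≺x)) (trans (sym same) (dec-false (x <? y) (asym y≺x)))) λ ()

  oriented⇒≺ : InducedOrientation D above ⇒ _≺_
  oriented⇒≺ {x} {y} (_ , x-below) = decidable-stable (x <? y) λ x⊀y →
    contradiction (trans (sym x-below) (dec-false (x <? y) x⊀y)) λ ()

  above-acyclic : Acyclic D (InducedOrientation D above)
  above-acyclic x cycle = irrefl refl (transClosure-least ≺-trans oriented⇒≺ cycle)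

module FromColouring (D : Digraph) {col : V D → V D → Bool}
                     (respects : RespectsCopies D col) (bipartite : IsBipartition D col)
                     (acyclic : Acyclic D (InducedOrientation D col)) where
  open DigraphProperties D
  open Digraph D using (adj)

  oriented? : Decidable (InducedOrientation D col)
  oriented? x y = (T? (adj x y) ⊎-dec T? (adj y x)) ×-dec (col x y ≟ᵇ true)

  linearExtension : ∃ λ (_≺_ : Rel (V D) 0ℓ) →
                    IsStrictTotalOrder _≡_ _≺_ × InducedOrientation D col ⇒ _≺_
  linearExtension = acyclic⇒linearExtension oriented? acyclic

  _≺_ : Rel (V D) 0ℓ
  _≺_ = proj₁ linearExtension

  ≺-isStrictTotalOrder : IsStrictTotalOrder _≡_ _≺_
  ≺-isStrictTotalOrder = proj₁ (proj₂ linearExtension)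

  oriented⇒≺ : InducedOrientation D col ⇒ _≺_
  oriented⇒≺ = proj₂ (proj₂ linearExtension)

  open IsStrictTotalOrder ≺-isStrictTotalOrder using (irrefl; asym) renaming (trans to ≺-trans)

  col-agrees : ∀ {x y} → Adjacent D x y → x ≺ y → col x y ≡ true
  col-agrees {x} {y} xy x≺y with col x y in xy-col | col y x in yx-col
  ... | true  | _     = refl
  ... | false | true  = ⊥-elim (asym x≺y (oriented⇒≺ (Adjacent-sym xy , yx-col)))
  ... | false | false = ⊥-elim (bipartite x y xy (trans xy-col (sym yx-col)))

  unforced-across : ∀ {x y z} → x ≺ y → y ≺ z → Adjacent D y x → Adjacent D y z →
                    ¬ Forces D y x y z
  unforced-across {x} {y} {z} x≺y y≺z yx yz f = bipartite x y (Adjacent-sym yx) (begin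
    col x y ≡⟨ col-agrees (Adjacent-sym yx) x≺y ⟩
    true    ≡⟨ col-agrees yz y≺z ⟨
    col y z ≡⟨ respects y x z yx yz ((yx , yz , f) ◅ ε) ⟨
    col y x ∎)
    where open ≡-Reasoning

  ≺-isComparabilityOrdering : IsComparabilityOrdering D _≺_
  ≺-isComparabilityOrdering = ≺-isStrictTotalOrder , transitivities
    where
    transitivities : ∀ x y z → x ≺ y → y ≺ z →
                     (Arc D x y → Arc D y z → Arc D x z) × (Arc D z y → Arc D y x → Arc D z x)
    transitivities x y z x≺y y≺z = forwards , backwards
      where
      x≢z : x ≢ z
      x≢z refl = irrefl refl (≺-trans x≺y y≺z)

      forwards : Arc D x y → Arc D y z → Arc D x z
      forwards xy yz = decidable-stable (T? (adj x z)) λ ¬xz →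
        unforced-across x≺y y≺z (inj₂ xy) (inj₁ yz) (inj₂ (inj₁ (refl , x≢z , inj₁ (xy , yz , ¬xz))))

      backwards : Arc D z y → Arc D y x → Arc D z x
      backwards zy yx = decidable-stable (T? (adj z x)) λ ¬zx →
        unforced-across x≺y y≺z (inj₁ yx) (inj₂ zy) (inj₂ (inj₁ (refl , x≢z , inj₂ (zy , yx , ¬zx))))

mainTheorem1 : (D : Digraph) →
    IsComparabilityDigraph D ⇔
      Σ (V D → V D → Bool) (λ col →
        RespectsCopies D col × IsBipartition D col ×
        Acyclic D (InducedOrientation D col))
mainTheorem1 D = mk⇔
  (λ (_ , comparability) → let open FromComparabilityOrdering D comparability in
    above , above-respectsCopies , above-isBipartition , above-acyclic)
  (λ (_ , respects , bipartite , acyclic) →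
    _ , FromColouring.≺-isComparabilityOrdering D respects bipartite acyclic)
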